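{- Let $G$ be a connected chordal graph and $S,T$ distinct vertices of $G$. If $u$ is a bad vertex, then no non-separating simple path from $S$ to $T$ visits $u$.
   Context: A chordal graph is a simple undirected graph in which every cycle with four or more vertices has a chord. A path is a sequence $p_0,\dots,p_{|p|-1}$ of vertices with consecutive vertices adjacent; it is simple if its vertices are distinct; $p_{i,j}$ is the subpath $p_i,\dots,p_j$, and $p$ contains $q$ if $q=p_{i,j}$ for some $i\le j$. A path is separating if removing all of its edges from $G$ disconnects $G$, and non-separating otherwise. A separator path is a simple separating path not containing any separating path other than itself. A separator path $r$ is traversable if there is a simple path from $S$ to $T$ that contains $r$. A vertex $v$ is bad if there exists a traversable separator path $r=r_0,r_1,r_2$ with exactly two edges such that $r_1=v$. -}

module Defs where

open import Data.Nat using (ℕ; _≤_)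
open import Data.Fin using (Fin)
open import Data.List using (List; []; _∷_; _++_; [_]; length)
open import Data.List.Membership.Propositional using (_∈_)
open import Data.List.Relation.Unary.Unique.Propositional using (Unique)
open import Data.Product using (Σ; ∃; ∃-syntax; _×_; _,_)
open import Data.Sum using (_⊎_)
open import Data.Empty using (⊥)
open import Relation.Nullary using (¬_)
open import Relation.Binary.PropositionalEquality using (_≡_; _≢_)
open import Relation.Binary.Construct.Closure.ReflexiveTransitive using (Star)

record Graph (n : ℕ) : Set₁ where
  field
    Adj   : Fin n → Fin n → Set
    sym   : ∀ {x y} → Adj x y → Adj y x
    irrfl : ∀ {x} → ¬ Adj x x
open Graph public

module _ {n : ℕ} where

  V : Set
  V = Fin n

  data Walk (R : V → V → Set) : List V → Set where
    single : ∀ x → Walk R [ x ]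
    step   : ∀ x y p → R x y → Walk R (y ∷ p) → Walk R (x ∷ y ∷ p)

  IsPath : Graph n → List V → Set
  IsPath G p = Walk (Adj G) p

  IsSimplePath : Graph n → List V → Set
  IsSimplePath G p = IsPath G p × Unique p

  FromTo : List V → V → V → Set
  FromTo p s t = (∃[ ys ] p ≡ s ∷ ys) × (∃[ zs ] p ≡ zs ++ [ t ])

  DirEdgeOf : List V → V → V → Set
  DirEdgeOf p x y = ∃[ xs ] ∃[ ys ] p ≡ xs ++ (x ∷ y ∷ ys)

  EdgeOf : List V → V → V → Set
  EdgeOf p x y = DirEdgeOf p x y ⊎ DirEdgeOf p y x

  Remove : Graph n → List V → V → V → Set
  Remove G p x y = Adj G x y × ¬ EdgeOf p x y

  ConnectedRel : (V → V → Set) → Set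
  ConnectedRel R = ∀ x y → Star R x y

  Connected : Graph n → Set
  Connected G = ConnectedRel (Adj G)

  Separating : Graph n → List V → Set
  Separating G p = ¬ ConnectedRel (Remove G p)

  Contains : List V → List V → Set
  Contains p q = ∃[ xs ] ∃[ ys ] p ≡ xs ++ q ++ ys

  SeparatorPath : Graph n → List V → Set
  SeparatorPath G r =
    IsSimplePath G r × Separating G r ×
    (∀ q → IsPath G q → Contains r q → Separating G q → q ≡ r)

  Traversable : Graph n → V → V → List V → Set
  Traversable G S T r =
    SeparatorPath G r × ∃[ P ] (IsSimplePath G P × FromTo P S T × Contains P r)

  Bad : Graph n → V → V → V → Set
  Bad G S T v = ∃[ r₀ ] ∃[ r₂ ] Traversable G S T (r₀ ∷ v ∷ r₂ ∷ [])

  IsCycle : Graph n → List V → Set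
  IsCycle G [] = ⊥
  IsCycle G (c ∷ cs) = Unique (c ∷ cs) × IsPath G ((c ∷ cs) ++ [ c ])

  HasChord : Graph n → List V → Set
  HasChord G [] = ⊥
  HasChord G (c ∷ cs) =
    ∃[ x ] ∃[ y ] (x ∈ (c ∷ cs) × y ∈ (c ∷ cs) × Adj G x y ×
                   ¬ EdgeOf ((c ∷ cs) ++ [ c ]) x y)

  Chordal : Graph n → Set
  Chordal G = ∀ c → 4 ≤ length c → IsCycle G c → HasChord G c

-- Let r = r₀ u r₂ be a traversable separator path and p a simple S–T path
-- through u, with neighbours a and b on p. Removing the edges of r leaves S
-- joined to r₀ and r₂ joined to T (along the traversing path), and S joined to
-- a and b joined to T (along p). Since the two halves r₀u and ur₂ of r are
-- non-separating, removing r must cut u off from r₀ and from r₂; so the edge au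
-- must belong to r, i.e. a ∈ {r₀, r₂}, and likewise b. Hence {a, b} = {r₀, r₂},
-- every edge of r lies on p, and p is separating because r is.
module Submission where

open import Defs hiding (sym)
open import Data.Nat using (ℕ)
open import Data.Fin using (Fin; _≟_)
open import Data.List using (List; []; _∷_; _++_; [_]; initLast; _∷ʳ′_)
open import Data.List.Membership.Propositional using (_∈_; _∉_)
open import Data.List.Membership.Propositional.Properties using (∈-∃++; ∈-++⁺ʳ)
open import Data.List.Relation.Unary.All using (lookup)
open import Data.List.Relation.Unary.All.Properties using (All¬⇒¬Any)
open import Data.List.Relation.Unary.Any using (here; there)
open import Data.List.Relation.Unary.AllPairs using (_∷_)
open import Data.List.Relation.Unary.Unique.Propositional using (Unique)
open import Data.List.Properties using (++-assoc; ++-conicalʳ; ∷-injectiveˡ; ∷-injectiveʳ; ∷ʳ-injective)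
open import Data.Product using (∃-syntax; _×_; _,_; proj₁; proj₂)
open import Data.Sum as Sum using (_⊎_; inj₁; inj₂; [_,_]′; swap)
open import Data.Empty using (⊥-elim)
open import Function using (_∘_; id; case_of_)
open import Relation.Nullary using (¬_; yes; no; Dec)
open import Relation.Nullary.Decidable using (map′; _×-dec_; _⊎-dec_)
open import Relation.Binary.Core using (_⇒_)
open import Relation.Binary.Construct.Union using (_∪_)
open import Relation.Binary.PropositionalEquality using (_≡_; _≢_; refl; sym; trans; subst; cong)
open import Relation.Binary.Construct.Closure.ReflexiveTransitive as Star using (Star; ε; _◅_; _◅◅_; reverse; kleisliStar)

module _ {n : ℕ} where

  private
    Vertex = Fin n

  variable
    R : Vertex → Vertex → Set
    a b c r₀ r₂ S T u v x y z : Vertex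
    p q P xs ys : List Vertex

  walk-split : ∀ xs → Walk R (xs ++ y ∷ ys) → Walk R (xs ++ [ y ]) × Walk R (y ∷ ys)
  walk-split []           w                 = single _ , w
  walk-split (_ ∷ [])     (step _ _ _ r w)  = step _ _ _ r (single _) , w
  walk-split (_ ∷ x ∷ xs) (step _ _ _ r w) with walk-split (x ∷ xs) w
  ... | w₁ , w₂ = step _ _ _ r w₁ , w₂

  ∉-∈⇒≢ : v ∉ p → x ∈ p → v ≢ x
  ∉-∈⇒≢ v∉p x∈p refl = v∉p x∈p

  walk⇒star : Walk R p → FromTo p x y → Star R x y
  walk⇒star (single _) ((_ , refl) , ([] , refl)) = ε
  walk⇒star (single _) (_ , (_ ∷ zs , eq))
    with () ← ++-conicalʳ zs _ (sym (∷-injectiveʳ eq))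
  walk⇒star (step _ _ _ r w) ((_ , refl) , ([] , ()))
  walk⇒star (step _ _ _ r w) ((_ , refl) , (_ ∷ zs , eq)) =
    r ◅ walk⇒star w ((_ , refl) , (zs , ∷-injectiveʳ eq))

  fromTo-prefix : ∀ xs → FromTo (xs ++ y ∷ ys) S T → FromTo (xs ++ [ y ]) S y
  fromTo-prefix []       ((_ , refl) , _) = ([] , refl) , ([] , refl)
  fromTo-prefix (x ∷ xs) ((_ , eq) , _)   =
    (xs ++ [ _ ] , cong (_∷ _) (∷-injectiveˡ eq)) , (x ∷ xs , refl)

  fromTo-suffix : ∀ xs → FromTo (xs ++ y ∷ ys) S T → FromTo (y ∷ ys) y T
  fromTo-suffix xs (_ , ends) = (_ , refl) , suffix-ends xs ends
    where
    suffix-ends : ∀ xs → ∃[ zs ] xs ++ y ∷ ys ≡ zs ++ [ T ] →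
                  ∃[ zs ] y ∷ ys ≡ zs ++ [ T ]
    suffix-ends []       ends           = ends
    suffix-ends (_ ∷ xs) ([] , eq)      with () ← ++-conicalʳ xs _ (∷-injectiveʳ eq)
    suffix-ends (_ ∷ xs) (_ ∷ zs , eq)  = suffix-ends xs (zs , ∷-injectiveʳ eq)

  fromTo⇒source∈ : FromTo p S T → S ∈ p
  fromTo⇒source∈ ((_ , refl) , _) = here refl

  fromTo⇒target∈ : FromTo p S T → T ∈ p
  fromTo⇒target∈ (_ , (zs , refl)) = ∈-++⁺ʳ zs (here refl)

  edgeOf-before : DirEdgeOf (xs ++ a ∷ b ∷ ys) a b
  edgeOf-before = _ , _ , refl

  edgeOf-after : DirEdgeOf (xs ++ a ∷ b ∷ c ∷ ys) b c
  edgeOf-after {xs} {a} = xs ++ [ a ] , _ , sym (++-assoc xs [ a ] _)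

  interior-vertex : FromTo p S T → u ∈ p → u ≢ S → u ≢ T →
    ∃[ xs ] ∃[ a ] ∃[ b ] ∃[ ys ] p ≡ xs ++ a ∷ u ∷ b ∷ ys
  interior-vertex ((_ , starts) , (_ , ends)) u∈p u≢S u≢T with ∈-∃++ u∈p
  ... | pre , post , refl with initLast pre | post
  ... | []           | _      = ⊥-elim (u≢S (∷-injectiveˡ starts))
  ... | xs ∷ʳ′ a     | []     = ⊥-elim (u≢T (proj₂ (∷ʳ-injective _ _ ends)))
  ... | xs ∷ʳ′ a     | b ∷ ys = xs , a , b , ys , ++-assoc xs [ a ] _

  unique⇒∉-around : ∀ xs → Unique (xs ++ y ∷ ys) → y ∉ xs × y ∉ ys
  unique⇒∉-around []       (y≢ys ∷ _) = (λ ()) , All¬⇒¬Any y≢ys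
  unique⇒∉-around (x ∷ xs) (x≢ ∷ uq) with unique⇒∉-around xs uq
  ... | y∉xs , y∉ys = (λ { (here y≡x) → lookup x≢ (∈-++⁺ʳ xs (here refl)) (sym y≡x)
                         ; (there y∈xs) → y∉xs y∈xs })
                      , y∉ys

  dirEdgeOf-∷⁻ : DirEdgeOf (x ∷ y ∷ q) a b → (a ≡ x × b ≡ y) ⊎ DirEdgeOf (y ∷ q) a b
  dirEdgeOf-∷⁻ ([] , _ , refl)      = inj₁ (refl , refl)
  dirEdgeOf-∷⁻ (_ ∷ xs , ys , eq)   = inj₂ (xs , ys , ∷-injectiveʳ eq)

  dirEdgeOf-[-] : ¬ DirEdgeOf [ x ] a b
  dirEdgeOf-[-] ([] , _ , ())
  dirEdgeOf-[-] (_ ∷ xs , _ , eq) with () ← ++-conicalʳ xs _ (sym (∷-injectiveʳ eq))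

  edgeOf-pair⁻ : EdgeOf (x ∷ y ∷ []) a b → (a ≡ x × b ≡ y) ⊎ (b ≡ x × a ≡ y)
  edgeOf-pair⁻ = Sum.map dirEdgeOf-pair⁻ dirEdgeOf-pair⁻
    where
    dirEdgeOf-pair⁻ : DirEdgeOf (x ∷ y ∷ []) a b → a ≡ x × b ≡ y
    dirEdgeOf-pair⁻ = [ id , ⊥-elim ∘ dirEdgeOf-[-] ]′ ∘ dirEdgeOf-∷⁻

  edgeOf-pair? : ∀ x y a b → Dec (EdgeOf (x ∷ y ∷ []) a b)
  edgeOf-pair? x y a b =
    map′ edgeOf-pair⁺ edgeOf-pair⁻ ((a ≟ x ×-dec b ≟ y) ⊎-dec (b ≟ x ×-dec a ≟ y))
    where
    edgeOf-pair⁺ : (a ≡ x × b ≡ y) ⊎ (b ≡ x × a ≡ y) → EdgeOf (x ∷ y ∷ []) a b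
    edgeOf-pair⁺ (inj₁ (refl , refl)) = inj₁ ([] , [] , refl)
    edgeOf-pair⁺ (inj₂ (refl , refl)) = inj₂ ([] , [] , refl)

  edgeOf-pair-⊆ : EdgeOf p x y → EdgeOf (x ∷ y ∷ []) ⇒ EdgeOf p
  edgeOf-pair-⊆ e xy with edgeOf-pair⁻ xy
  ... | inj₁ (refl , refl) = e
  ... | inj₂ (refl , refl) = swap e

  edgeOf-triple⁻ : EdgeOf (x ∷ y ∷ z ∷ []) ⇒ EdgeOf (x ∷ y ∷ []) ∪ EdgeOf (y ∷ z ∷ [])
  edgeOf-triple⁻ (inj₁ d) = Sum.map inj₁ inj₁ (dirEdgeOf-triple⁻ d)
    where
    dirEdgeOf-triple⁻ : DirEdgeOf (x ∷ y ∷ z ∷ []) a b →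
                        DirEdgeOf (x ∷ y ∷ []) a b ⊎ DirEdgeOf (y ∷ z ∷ []) a b
    dirEdgeOf-triple⁻ d with dirEdgeOf-∷⁻ d
    ... | inj₁ (refl , refl) = inj₁ ([] , [] , refl)
    ... | inj₂ d′            = inj₂ d′
  edgeOf-triple⁻ (inj₂ d) = Sum.map swap swap (edgeOf-triple⁻ (inj₁ d))

  edgeOf-triple-⊆ : EdgeOf p x y → EdgeOf p y z → EdgeOf (x ∷ y ∷ z ∷ []) ⇒ EdgeOf p
  edgeOf-triple-⊆ xy yz = [ edgeOf-pair-⊆ xy , edgeOf-pair-⊆ yz ]′ ∘ edgeOf-triple⁻

  edgeOf-triple⇒middle : EdgeOf (x ∷ y ∷ z ∷ []) a b → a ≡ y ⊎ b ≡ y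
  edgeOf-triple⇒middle e with edgeOf-triple⁻ e
  ... | inj₁ xy = Sum.map proj₂ proj₂ (swap (edgeOf-pair⁻ xy))
  ... | inj₂ yz = Sum.map proj₁ proj₁ (edgeOf-pair⁻ yz)

  edgeOf-triple-at-middle : EdgeOf (x ∷ y ∷ z ∷ []) a y → a ≡ x ⊎ a ≡ z
  edgeOf-triple-at-middle e with edgeOf-triple⁻ e
  ... | inj₁ xy = inj₁ ([ proj₁ , (λ (y≡x , a≡y) → trans a≡y y≡x) ]′ (edgeOf-pair⁻ xy))
  ... | inj₂ yz = inj₂ ([ (λ (a≡y , y≡z) → trans a≡y y≡z) , proj₂ ]′ (edgeOf-pair⁻ yz))

  module _ (G : Graph n) where

    remove-sym : Remove G p x y → Remove G p y x
    remove-sym (adj , ¬e) = Graph.sym G adj , ¬e ∘ swap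

    remove-antitone : EdgeOf q ⇒ EdgeOf p → Remove G p ⇒ Remove G q
    remove-antitone q⊆p (adj , ¬e) = adj , ¬e ∘ q⊆p

    separating-mono : EdgeOf q ⇒ EdgeOf p → Separating G q → Separating G p
    separating-mono q⊆p sep conn = sep λ a b → Star.map (remove-antitone q⊆p) (conn a b)

    -- Each edge of G − q missing from G − p is the edge xy, which the detour replaces.
    remove-connected-by-detour : EdgeOf p ⇒ EdgeOf q ∪ EdgeOf (x ∷ y ∷ []) →
      Star (Remove G p) x y → ConnectedRel (Remove G q) → ConnectedRel (Remove G p)
    remove-connected-by-detour {p} {q} {x} {y} p⊆q+xy detour conn a b =
      kleisliStar id edge (conn a b)
      where
      edge : Remove G q ⇒ Star (Remove G p)
      edge {a} {b} (adj , ¬e) with edgeOf-pair? x y a b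
      ... | no ¬xy = (adj , [ ¬e , ¬xy ]′ ∘ p⊆q+xy) ◅ ε
      ... | yes xy with edgeOf-pair⁻ xy
      ...   | inj₁ (refl , refl) = detour
      ...   | inj₂ (refl , refl) = reverse remove-sym detour

    walk-remove⁺ : (∀ {a b} → EdgeOf q a b → a ≡ v ⊎ b ≡ v) →
      Walk (Adj G) p → v ∉ p → Walk (Remove G q) p
    walk-remove⁺ at-v (single x)          v∉p = single x
    walk-remove⁺ at-v (step x y _ adj w) v∉p =
      step x y _ (adj , [ v∉p ∘ here ∘ sym , v∉p ∘ there ∘ here ∘ sym ]′ ∘ at-v)
        (walk-remove⁺ at-v w (v∉p ∘ there))

    flanking-segments : (∀ {a b} → EdgeOf q a b → a ≡ u ⊎ b ≡ u) →
      IsSimplePath G p → FromTo p S T → p ≡ xs ++ a ∷ u ∷ b ∷ ys →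
      (u ≢ S × Star (Remove G q) S a) × (u ≢ T × Star (Remove G q) b T)
    flanking-segments {q = q} {u = u} {S = S} {T = T} {xs = xs} {a = a} {b = b} {ys = ys}
                      at-u (walk , uniq) fromTo refl =
        (∉-∈⇒≢ u∉pre (fromTo⇒source∈ pre-fromTo) , segment pre-walk pre-fromTo u∉pre)
      , (∉-∈⇒≢ u∉post (fromTo⇒target∈ post-fromTo) , segment post-walk post-fromTo u∉post)
      where
      u∉sides : u ∉ xs ++ [ a ] × u ∉ b ∷ ys
      u∉sides =
        unique⇒∉-around (xs ++ [ a ]) (subst Unique (sym (++-assoc xs [ a ] _)) uniq)

      segment : ∀ {s c d} → Walk (Adj G) s → FromTo s c d → u ∉ s → Star (Remove G q) c d
      segment w ft u∉s = walk⇒star (walk-remove⁺ at-u w u∉s) ft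

      pre-walk : Walk (Adj G) (xs ++ [ a ])
      pre-walk = proj₁ (walk-split xs walk)

      post-walk : Walk (Adj G) (b ∷ ys)
      post-walk with walk-split xs walk
      ... | _ , step _ _ _ _ (step _ _ _ _ w) = w

      pre-fromTo : FromTo (xs ++ [ a ]) S a
      pre-fromTo = fromTo-prefix xs fromTo

      post-fromTo : FromTo (b ∷ ys) b T
      post-fromTo = fromTo-suffix (a ∷ u ∷ []) (fromTo-suffix xs fromTo)

      u∉pre : u ∉ xs ++ [ a ]
      u∉pre = proj₁ u∉sides

      u∉post : u ∉ b ∷ ys
      u∉post = proj₂ u∉sides

    separatorPath-halves : SeparatorPath G (x ∷ y ∷ z ∷ []) →
      ¬ Separating G (x ∷ y ∷ []) × ¬ Separating G (y ∷ z ∷ [])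
    separatorPath-halves ((walk , _) , _ , minimal) =
        (λ sep → case minimal _ (proj₁ (walk-split (_ ∷ []) walk)) ([] , _ , refl) sep of λ ())
      , (λ sep → case minimal _ (proj₂ (walk-split (_ ∷ []) walk)) (_ ∷ [] , [] , refl) sep of λ ())

    module MinimalSeparatingTriple {r₀ u r₂ : Fin n}
      (separating  : Separating G (r₀ ∷ u ∷ r₂ ∷ []))
      (left-half   : ¬ Separating G (r₀ ∷ u ∷ []))
      (right-half  : ¬ Separating G (u ∷ r₂ ∷ [])) where

      private
        G−r = Remove G (r₀ ∷ u ∷ r₂ ∷ [])

      u-cut-from-r₀ : ¬ Star G−r r₀ u
      u-cut-from-r₀ r₀~u =
        right-half λ conn →
          separating (remove-connected-by-detour (swap ∘ edgeOf-triple⁻) r₀~u conn)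

      u-cut-from-r₂ : ¬ Star G−r u r₂
      u-cut-from-r₂ u~r₂ =
        left-half λ conn → separating (remove-connected-by-detour edgeOf-triple⁻ u~r₂ conn)

      neighbour-before : Star G−r r₀ a → Adj G a u → a ≡ r₀ ⊎ a ≡ r₂
      neighbour-before {a} r₀~a adj with a ≟ r₀ | a ≟ r₂
      ... | yes a≡r₀ | _        = inj₁ a≡r₀
      ... | no _     | yes a≡r₂ = inj₂ a≡r₂
      ... | no a≢r₀  | no a≢r₂  =
        ⊥-elim (u-cut-from-r₀ (r₀~a ◅◅ (adj , [ a≢r₀ , a≢r₂ ]′ ∘ edgeOf-triple-at-middle) ◅ ε))

      neighbour-after : Star G−r b r₂ → Adj G u b → b ≡ r₀ ⊎ b ≡ r₂
      neighbour-after {b} b~r₂ adj with b ≟ r₀ | b ≟ r₂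
      ... | yes b≡r₀ | _        = inj₁ b≡r₀
      ... | no _     | yes b≡r₂ = inj₂ b≡r₂
      ... | no b≢r₀  | no b≢r₂  =
        ⊥-elim (u-cut-from-r₂
          ((adj , [ b≢r₀ , b≢r₂ ]′ ∘ edgeOf-triple-at-middle ∘ swap) ◅ b~r₂))

      neighbours-are-ends : IsSimplePath G (xs ++ a ∷ u ∷ b ∷ ys) →
        Star G−r r₀ a → Star G−r b r₂ → (a ≡ r₀ × b ≡ r₂) ⊎ (a ≡ r₂ × b ≡ r₀)
      neighbours-are-ends {xs} {a} {b} (walk , uniq) r₀~a b~r₂
        with walk-split xs walk | unique⇒∉-around xs uniq
      ... | _ , step _ _ _ au (step _ _ _ ub _) | _ , a∉rest =
        ends (neighbour-before r₀~a au) (neighbour-after b~r₂ ub)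
        where
        a≢b : a ≢ b
        a≢b = a∉rest ∘ there ∘ here

        ends : a ≡ r₀ ⊎ a ≡ r₂ → b ≡ r₀ ⊎ b ≡ r₂ → (a ≡ r₀ × b ≡ r₂) ⊎ (a ≡ r₂ × b ≡ r₀)
        ends (inj₁ a≡r₀) (inj₁ b≡r₀) = ⊥-elim (a≢b (trans a≡r₀ (sym b≡r₀)))
        ends (inj₁ a≡r₀) (inj₂ b≡r₂) = inj₁ (a≡r₀ , b≡r₂)
        ends (inj₂ a≡r₂) (inj₁ b≡r₀) = inj₂ (a≡r₂ , b≡r₀)
        ends (inj₂ a≡r₂) (inj₂ b≡r₂) = ⊥-elim (a≢b (trans a≡r₂ (sym b≡r₂)))

      triple-on-path : (a ≡ r₀ × b ≡ r₂) ⊎ (a ≡ r₂ × b ≡ r₀) →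
        EdgeOf (r₀ ∷ u ∷ r₂ ∷ []) ⇒ EdgeOf (xs ++ a ∷ u ∷ b ∷ ys)
      triple-on-path {xs = xs} (inj₁ (refl , refl)) =
        edgeOf-triple-⊆ (inj₁ (edgeOf-before {xs = xs})) (inj₁ (edgeOf-after {xs = xs}))
      triple-on-path {xs = xs} (inj₂ (refl , refl)) =
        edgeOf-triple-⊆ (inj₂ (edgeOf-after {xs = xs})) (inj₂ (edgeOf-before {xs = xs}))

      not-on-nonseparating-path :
        IsSimplePath G P → FromTo P S T → Contains P (r₀ ∷ u ∷ r₂ ∷ []) →
        IsSimplePath G p → FromTo p S T → ¬ Separating G p → u ∉ p
      not-on-nonseparating-path P-simple P-fromTo (_ , _ , P≡) p-simple p-fromTo p-nonsep u∈p
        with flanking-segments edgeOf-triple⇒middle P-simple P-fromTo P≡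
      ... | (u≢S , S~r₀) , (u≢T , r₂~T) with interior-vertex p-fromTo u∈p u≢S u≢T
      ... | xs , a , b , ys , refl
        with flanking-segments edgeOf-triple⇒middle p-simple p-fromTo refl
      ... | (_ , S~a) , (_ , b~T) =
        p-nonsep (separating-mono (triple-on-path {xs = xs} ends) separating)
        where
        ends : (a ≡ r₀ × b ≡ r₂) ⊎ (a ≡ r₂ × b ≡ r₀)
        ends = neighbours-are-ends p-simple
          (reverse remove-sym S~r₀ ◅◅ S~a) (b~T ◅◅ reverse remove-sym r₂~T)

open MinimalSeparatingTriple using (not-on-nonseparating-path)

theorem5 : {n : ℕ} (G : Graph n) → Connected G → Chordal G →
    (S T : Fin n) → S ≢ T → (u : Fin n) → Bad G S T u →
    (p : List (Fin n)) → IsSimplePath G p → FromTo p S T →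
    ¬ Separating G p → u ∉ p
theorem5 G _ _ _ _ _ u
         (r₀ , r₂ , r-separator@(_ , separating , _) , _ , P-simple , P-fromTo , P⊇r)
         _ p-simple p-fromTo p-nonsep =
  not-on-nonseparating-path G separating left-half right-half
    P-simple P-fromTo P⊇r p-simple p-fromTo p-nonsep
  where
  left-half : ¬ Separating G (r₀ ∷ u ∷ [])
  left-half = proj₁ (separatorPath-halves G r-separator)

  right-half : ¬ Separating G (u ∷ r₂ ∷ [])
  right-half = proj₂ (separatorPath-halves G r-separator)
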